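{- For all positive integers $n$ and $g$, $\frac{\eta_g(n)}{\sqrt{n}}\le 2\left(1+\frac{1}{\sqrt{n}}\right)g$.
   Context: For a positive integer $n$ write $[n]=\{1,\dots,n\}$. For a set $A$ of integers and an integer $d$, let $r_{A-A}(d)=|\{(a,a')\in A\times A: d=a-a'\}|$. Define $\eta_g(n)=\min\{|A| : A\subseteq\mathbb{Z},\ r_{A-A}(x)\ge g\text{ for all }x\in[n]\}$. -}

module Defs where

open import Data.Nat using (ℕ; suc; _≤_)
open import Data.Integer as ℤ using (ℤ; +_; _-_)
open import Data.List using (List; length; filter; cartesianProduct)
open import Data.List.Relation.Unary.Unique.Propositional using (Unique)
open import Data.Product using (_×_; _,_; proj₁; proj₂; Σ)
open import Relation.Binary.PropositionalEquality using (_≡_)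

record FinSetℤ : Set where
  constructor mkSet
  field
    elems  : List ℤ
    unique : Unique elems

open FinSetℤ public

card : FinSetℤ → ℕ
card A = length (elems A)

r : FinSetℤ → ℤ → ℕ
r A d = length (filter (λ p → d ℤ.≟ (proj₁ p - proj₂ p))
                       (cartesianProduct (elems A) (elems A)))

Good : ℕ → ℕ → FinSetℤ → Set
Good g n A = (x : ℕ) → 1 ≤ x → x ≤ n → g ≤ r A (+ x)

IsEta : ℕ → ℕ → ℕ → Set
IsEta g n m = Σ FinSetℤ (λ A → Good g n A × card A ≡ m)
            × ((A : FinSetℤ) → Good g n A → m ≤ card A)

-- The set B_s = {0, …, s-1} ∪ {s, 2s, …, s·s} has 2s elements and contains every
-- d ∈ [1, s²] as a difference, since d = (j+1)s - l with j, l < s.  The union of g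
-- translates of B_s spaced s² + 1 apart is duplicate-free, and each translate
-- contributes its own representation of d, so η_g(n) ≤ 2gs for s = ⌈√n⌉ ≤ 1 + √n.
module Submission where

open import Defs
open import Data.Nat using (ℕ; zero; suc; _+_; _*_; _∸_; _≤_; _<_; z≤n; s≤s; _≤?_)
open import Data.Nat.Properties
open import Data.Nat.DivMod using (_/_; _%_; m≡m%n+[m/n]*n; m%n<n; m<n*o⇒m/o<n)
open import Data.Nat.Tactic.RingSolver using (solve-∀)
open import Data.Integer as ℤ using (ℤ; +_; _-_)
import Data.Integer.Properties as ℤ
open import Data.List using (List; []; _∷_; _++_; map; length; filter; concat;
  applyUpTo; upTo; cartesianProduct)
open import Data.List.Properties using (length-map; length-++; length-applyUpTo;
  filter-++; concat-map; cartesianProductWith-distribʳ-++)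
open import Data.List.Membership.Propositional using (_∈_)
open import Data.List.Membership.Propositional.Properties using (∈-map⁺; ∈-++⁺ˡ;
  ∈-++⁺ʳ; ∈-applyUpTo⁺; ∈-concat⁺′; ∈-filter⁺; ∈-cartesianProduct⁺; ∈-length)
open import Data.List.Relation.Unary.All as All using (All; []; _∷_)
import Data.List.Relation.Unary.All.Properties as All
open import Data.List.Relation.Unary.AllPairs as AllPairs using (AllPairs)
import Data.List.Relation.Unary.AllPairs.Properties as AllPairs
import Data.List.Relation.Unary.Unique.Propositional.Properties as Unique
open import Data.Product using (∃; ∃₂; _×_; _,_; proj₁; proj₂)
open import Function using (_∘_; id)
open import Relation.Nullary using (Dec; yes; no)
open import Relation.Binary.PropositionalEquality

difference? : ∀ d (p : ℤ × ℤ) → Dec (d ≡ proj₁ p - proj₂ p)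
difference? d p = d ℤ.≟ (proj₁ p - proj₂ p)

pairCount : List ℤ → List ℤ → ℤ → ℕ
pairCount xs ys d = length (filter (difference? d) (cartesianProduct xs ys))

pairCount-++ˡ : ∀ xs xs′ ys d →
  pairCount (xs ++ xs′) ys d ≡ pairCount xs ys d + pairCount xs′ ys d
pairCount-++ˡ xs xs′ ys d = begin
  pairCount (xs ++ xs′) ys d
    ≡⟨ cong (length ∘ filter P?) (cartesianProductWith-distribʳ-++ _,_ xs xs′ ys) ⟩
  length (filter P? (cartesianProduct xs ys ++ cartesianProduct xs′ ys))
    ≡⟨ cong length (filter-++ P? (cartesianProduct xs ys) _) ⟩
  length (filter P? (cartesianProduct xs ys) ++ filter P? (cartesianProduct xs′ ys))
    ≡⟨ length-++ (filter P? (cartesianProduct xs ys)) ⟩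
  pairCount xs ys d + pairCount xs′ ys d ∎
  where
  open ≡-Reasoning
  P? = difference? d

pairCount-pos : ∀ {xs ys x y d} → x ∈ xs → y ∈ ys → d ≡ x - y → 1 ≤ pairCount xs ys d
pairCount-pos {d = d} x∈xs y∈ys d≡x-y =
  ∈-length (∈-filter⁺ (difference? d) (∈-cartesianProduct⁺ x∈xs y∈ys) d≡x-y)

DifferenceBetween : ℤ → List ℤ → List ℤ → Set
DifferenceBetween d xs ys = ∃₂ λ x y → x ∈ xs × y ∈ ys × d ≡ x - y

pairCount-concat : ∀ {d ys} xss → All (λ xs → DifferenceBetween d xs ys) xss →
  length xss ≤ pairCount (concat xss) ys d
pairCount-concat [] [] = z≤n
pairCount-concat {d} {ys} (xs ∷ xss) ((_ , _ , x∈xs , y∈ys , d≡x-y) ∷ rest) = begin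
  1 + length xss
    ≤⟨ +-mono-≤ (pairCount-pos x∈xs y∈ys d≡x-y) (pairCount-concat xss rest) ⟩
  pairCount xs ys d + pairCount (concat xss) ys d
    ≡⟨ pairCount-++ˡ xs (concat xss) ys d ⟨
  pairCount (concat (xs ∷ xss)) ys d ∎
  where open ≤-Reasoning

Represents : List ℕ → ℕ → Set
Represents xs d = ∃₂ λ a b → a ∈ xs × b ∈ xs × b + d ≡ a

+[m+n]-[+m]≡+n : ∀ m n → + (m + n) - + m ≡ + n
+[m+n]-[+m]≡+n m n = begin
  + (m + n) - + m  ≡⟨ ℤ.[+m]-[+n]≡m⊖n (m + n) m ⟩
  (m + n) ℤ.⊖ m    ≡⟨ ℤ.⊖-≥ (m≤m+n m n) ⟩
  + (m + n ∸ m)    ≡⟨ cong +_ (m+n∸m≡n m n) ⟩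
  + n              ∎
  where open ≡-Reasoning

represents-count : ∀ {d} xss → All (λ xs → Represents xs d) xss →
  length xss ≤ pairCount (map +_ (concat xss)) (map +_ (concat xss)) (+ d)
represents-count {d} xss represents = begin
  length xss
    ≡⟨ length-map (map (+_)) xss ⟨
  length (map (map (+_)) xss)
    ≤⟨ pairCount-concat _ (All.map⁺ (All.tabulate lift)) ⟩
  pairCount (concat (map (map (+_)) xss)) A (+ d)
    ≡⟨ cong (λ zs → pairCount zs A (+ d)) (concat-map xss) ⟩
  pairCount A A (+ d) ∎
  where
  open ≤-Reasoning
  A = map +_ (concat xss)
  lift : ∀ {xs} → xs ∈ xss → DifferenceBetween (+ d) (map +_ xs) A
  lift {xs} xs∈xss with All.lookup represents xs∈xss
  ... | a , b , a∈xs , b∈xs , refl =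
    + a , + b , ∈-map⁺ +_ a∈xs , ∈-map⁺ +_ (∈-concat⁺′ b∈xs xs∈xss) , sym (+[m+n]-[+m]≡+n b d)

Represents-translate : ∀ c {xs d} → Represents xs d → Represents (map (_+_ c) xs) d
Represents-translate c (a , b , a∈xs , b∈xs , b+d≡a) =
  c + a , c + b , ∈-map⁺ (_+_ c) a∈xs , ∈-map⁺ (_+_ c) b∈xs ,
  trans (+-assoc c b _) (cong (_+_ c) b+d≡a)

basis : ℕ → List ℕ
basis s = upTo s ++ applyUpTo (λ j → suc j * s) s

length-basis : ∀ s → length (basis s) ≡ s + s
length-basis s = trans (length-++ (upTo s))
  (cong₂ _+_ (length-applyUpTo _ s) (length-applyUpTo _ s))

basis-represents : ∀ s {d} → 1 ≤ d → d ≤ s * s → Represents (basis s) d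
basis-represents zero {suc _} _ ()
basis-represents s@(suc s-1) {suc d-1} _ d≤s*s =
  suc q * s , s-1 ∸ ρ ,
  ∈-++⁺ʳ (upTo s) (∈-applyUpTo⁺ (λ j → suc j * s) q<s) ,
  ∈-++⁺ˡ (∈-applyUpTo⁺ id (s≤s (m∸n≤m s-1 ρ))) ,
  difference
  where
  -- writing d - 1 = q s + ρ, the difference is d = (q + 1) s - (s - 1 - ρ)
  q = d-1 / s
  ρ = d-1 % s
  q<s : q < s
  q<s = m<n*o⇒m/o<n d≤s*s
  difference : s-1 ∸ ρ + suc d-1 ≡ suc q * s
  difference = begin
    s-1 ∸ ρ + suc d-1        ≡⟨ +-suc (s-1 ∸ ρ) d-1 ⟩
    suc (s-1 ∸ ρ + d-1)      ≡⟨ cong (λ e → suc (s-1 ∸ ρ + e)) (m≡m%n+[m/n]*n d-1 s) ⟩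
    suc (s-1 ∸ ρ + (ρ + q * s)) ≡⟨ cong suc (+-assoc (s-1 ∸ ρ) ρ _) ⟨
    suc (s-1 ∸ ρ + ρ + q * s)   ≡⟨ cong (λ e → suc (e + q * s)) (m∸n+n≡m (≤-pred (m%n<n d-1 s))) ⟩
    suc q * s                ∎
    where open ≡-Reasoning

n≤1+n*n : ∀ n → n ≤ suc (n * n)
n≤1+n*n zero = z≤n
n≤1+n*n (suc n) = s≤s (≤-trans (n≤1+n n) (m≤m+n (suc n) (n * suc n)))

basis-bounded : ∀ s → All (_< suc (s * s)) (basis s)
basis-bounded s = All.++⁺
  (All.applyUpTo⁺₁ _ s (λ i<s → ≤-trans i<s (n≤1+n*n s)))
  (All.applyUpTo⁺₁ _ s (λ j<s → s≤s (*-monoˡ-≤ s j<s)))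

basis-sorted : ∀ s → AllPairs _<_ (basis s)
basis-sorted s = AllPairs.++⁺
  (AllPairs.applyUpTo⁺₁ _ s (λ i<j _ → i<j))
  (AllPairs.applyUpTo⁺₁ _ s (multiples-increasing s))
  (All.applyUpTo⁺₁ _ s (λ i<s → All.applyUpTo⁺₁ _ s (λ _ → ≤-trans i<s (m≤m+n s _))))
  where
  multiples-increasing : ∀ s {i j} → i < j → j < s → suc i * s < suc j * s
  multiples-increasing s@(suc _) i<j _ = *-monoˡ-< s (s≤s i<j)

block : ℕ → ℕ → List ℕ
block s i = map (_+_ (i * suc (s * s))) (basis s)

blocks : ℕ → ℕ → List (List ℕ)
blocks s g = applyUpTo (block s) g

block-bounded : ∀ s i → All (λ x → i * suc (s * s) ≤ x × x < suc i * suc (s * s)) (block s i)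
block-bounded s i = All.map⁺ (All.map bounds (basis-bounded s))
  where
  bounds : ∀ {b} → b < suc (s * s) → i * suc (s * s) ≤ i * suc (s * s) + b
                                     × i * suc (s * s) + b < suc i * suc (s * s)
  bounds {b} b<1+s*s = m≤m+n _ b , (begin-strict
    i * suc (s * s) + b            <⟨ +-monoʳ-< (i * suc (s * s)) b<1+s*s ⟩
    i * suc (s * s) + suc (s * s)  ≡⟨ +-comm (i * suc (s * s)) _ ⟩
    suc i * suc (s * s)            ∎)
    where open ≤-Reasoning

concat-blocks-sorted : ∀ s g → AllPairs _<_ (concat (blocks s g))
concat-blocks-sorted s g = AllPairs.concat⁺
  (All.applyUpTo⁺₂ _ g (λ i → AllPairs.map⁺ (AllPairs.map (+-monoʳ-< _) (basis-sorted s))))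
  (AllPairs.applyUpTo⁺₁ _ g (λ {i} {j} i<j _ →
    All.map (λ (_ , x<) → All.map (λ (y≥ , _) → <-≤-trans x< (≤-trans (*-monoˡ-≤ _ i<j) y≥))
                                  (block-bounded s j))
            (block-bounded s i)))

construction : ℕ → ℕ → FinSetℤ
construction s g = mkSet (map +_ (concat (blocks s g)))
  (Unique.map⁺ ℤ.+-injective (AllPairs.map <⇒≢ (concat-blocks-sorted s g)))

length-concat-uniform : ∀ {A : Set} {ℓ} (xss : List (List A)) →
  All (λ xs → length xs ≡ ℓ) xss → length (concat xss) ≡ length xss * ℓ
length-concat-uniform [] [] = refl
length-concat-uniform (xs ∷ xss) (refl ∷ lengths) =
  trans (length-++ xs) (cong (_+_ (length xs)) (length-concat-uniform xss lengths))

card-construction : ∀ s g → card (construction s g) ≡ g * (s + s)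
card-construction s g = begin
  length (map +_ (concat (blocks s g))) ≡⟨ length-map +_ (concat (blocks s g)) ⟩
  length (concat (blocks s g))          ≡⟨ length-concat-uniform _ (All.applyUpTo⁺₂ _ g length-block) ⟩
  length (blocks s g) * (s + s)         ≡⟨ cong (_* (s + s)) (length-applyUpTo _ g) ⟩
  g * (s + s)                           ∎
  where
  open ≡-Reasoning
  length-block : ∀ i → length (block s i) ≡ s + s
  length-block i = trans (length-map _ (basis s)) (length-basis s)

construction-good : ∀ s g {n} → n ≤ s * s → Good g n (construction s g)
construction-good s g n≤s*s d 1≤d d≤n = begin
  g                    ≡⟨ length-applyUpTo _ g ⟨
  length (blocks s g)  ≤⟨ represents-count (blocks s g) (All.applyUpTo⁺₂ _ g represents) ⟩
  r (construction s g) (+ d) ∎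
  where
  open ≤-Reasoning
  represents : ∀ i → Represents (block s i) d
  represents i = Represents-translate _ (basis-represents s 1≤d (≤-trans d≤n n≤s*s))

ceil-sqrt : ∀ n → ∃ λ s → n ≤ s * s × (s ∸ 1) * (s ∸ 1) ≤ n
ceil-sqrt zero = 0 , z≤n , z≤n
ceil-sqrt (suc n) with ceil-sqrt n
... | s , n≤s*s , [s∸1]²≤n with suc n ≤? s * s
...   | yes 1+n≤s*s = s , 1+n≤s*s , m≤n⇒m≤1+n [s∸1]²≤n
...   | no 1+n≰s*s = suc s , 1+n≤[1+s]² , m≤n⇒m≤1+n s*s≤n
  where
  s*s≤n : s * s ≤ n
  s*s≤n = ≤-pred (≰⇒> 1+n≰s*s)
  1+n≤[1+s]² : suc n ≤ suc s * suc s
  1+n≤[1+s]² = s≤s (begin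
    n              ≤⟨ n≤s*s ⟩
    s * s          ≤⟨ *-monoʳ-≤ s (n≤1+n s) ⟩
    s * suc s      ≤⟨ m≤n+m _ s ⟩
    s + s * suc s  ∎)
    where open ≤-Reasoning

IsEta⇒m≤g*[s+s] : ∀ {g n m} s → n ≤ s * s → IsEta g n m → m ≤ g * (s + s)
IsEta⇒m≤g*[s+s] {g} s n≤s*s (_ , minimal) = subst (_ ≤_) (card-construction s g)
  (minimal (construction s g) (construction-good s g n≤s*s))

corollary1 : (n g : ℕ) → 1 ≤ n → 1 ≤ g → (m : ℕ) → IsEta g n m →
    (m ∸ 2 * g) * (m ∸ 2 * g) ≤ 4 * g * g * n
corollary1 n g _ _ m eta with ceil-sqrt n
... | s , n≤s*s , [s∸1]²≤n = begin
  (m ∸ 2 * g) * (m ∸ 2 * g)              ≤⟨ *-mono-≤ m∸2g≤ m∸2g≤ ⟩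
  (2 * g * (s ∸ 1)) * (2 * g * (s ∸ 1))  ≡⟨ square-2gt g (s ∸ 1) ⟩
  4 * g * g * ((s ∸ 1) * (s ∸ 1))        ≤⟨ *-monoʳ-≤ (4 * g * g) [s∸1]²≤n ⟩
  4 * g * g * n                          ∎
  where
  open ≤-Reasoning
  square-2gt : ∀ g t → (2 * g * t) * (2 * g * t) ≡ 4 * g * g * (t * t)
  square-2gt = solve-∀
  double : ∀ g s → 2 * g * s ≡ g * (s + s)
  double = solve-∀
  m∸2g≤ : m ∸ 2 * g ≤ 2 * g * (s ∸ 1)
  m∸2g≤ = begin
    m ∸ 2 * g              ≤⟨ ∸-monoˡ-≤ (2 * g) (IsEta⇒m≤g*[s+s] s n≤s*s eta) ⟩
    g * (s + s) ∸ 2 * g    ≡⟨ cong₂ _∸_ (double g s) (*-identityʳ (2 * g)) ⟨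
    2 * g * s ∸ 2 * g * 1  ≡⟨ *-distribˡ-∸ (2 * g) s 1 ⟨
    2 * g * (s ∸ 1)        ∎
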